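{- For an integer $n\ge 1$, $f_4(n)=1$ if and only if the standard base-4 representation $n=\sum_{i=0}^m\delta_i4^i$ (with $\delta_i\in\{0,1,2,3\}$ and $\delta_m\neq0$) has all digits $\delta_0,\dots,\delta_m$ in $\{1,2,3\}$. For an integer $n$, $b_4(n)=1$ if and only if $n$ has a balanced quaternary representation $n=\sum_{i=0}^m\delta_i4^i$ with all digits $\delta_i\in\{ -1,0,1\}$.
   Context: For an integer $n$, a hyperquaternary representation of $n$ is an expression $n=\sum_{i\ge 0}\epsilon_i 4^i$ with finitely many nonzero $\epsilon_i$ and all $\epsilon_i\in\{0,1,2,3,4\}$; $f_4(n)$ denotes the number of such representations. A balanced quaternary representation of $n$ is such an expression with all $\epsilon_i\in\{ -2,-1,0,1,2\}$; $b_4(n)$ denotes the number of such representations. Representations differing only by leading zeros are identified. -}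

module Defs where

open import Data.Nat as ℕ using (ℕ; zero; suc)
open import Data.Integer as ℤ using (ℤ)
open import Data.List using (List; []; _∷_)
open import Data.List.Relation.Unary.All using (All)
open import Data.Product using (Σ; _×_)
open import Data.Unit using (⊤)
open import Relation.Binary.PropositionalEquality using (_≡_; _≢_)

-- A digit list [ε₀, ε₁, …, ε_m] represents Σ εᵢ 4^i (least significant first).
valℕ : List ℕ → ℕ
valℕ []       = 0
valℕ (d ∷ ds) = d ℕ.+ 4 ℕ.* valℕ ds

valℤ : List ℤ → ℤ
valℤ []       = ℤ.0ℤ
valℤ (d ∷ ds) = d ℤ.+ ℤ.+ 4 ℤ.* valℤ ds

-- No leading zeros (i.e. the last = most significant digit is nonzero, or the list is empty).
-- This picks the canonical member of each class "differing only by leading zeros".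
NormN : List ℕ → Set
NormN []           = ⊤
NormN (d ∷ [])     = d ≢ 0
NormN (_ ∷ e ∷ ds) = NormN (e ∷ ds)

NormZ : List ℤ → Set
NormZ []           = ⊤
NormZ (d ∷ [])     = d ≢ ℤ.0ℤ
NormZ (_ ∷ e ∷ ds) = NormZ (e ∷ ds)

ExactlyOne : {A : Set} → (A → Set) → Set
ExactlyOne {A} P = Σ A (λ x → P x × ((y : A) → P y → y ≡ x))

HyperRep : ℕ → List ℕ → Set
HyperRep n ds = All (λ d → d ℕ.≤ 4) ds × NormN ds × valℕ ds ≡ n

f₄≡1 : ℕ → Set
f₄≡1 n = ExactlyOne (HyperRep n)

BalRep : ℤ → List ℤ → Set
BalRep n ds = All (λ d → ℤ.- ℤ.+ 2 ℤ.≤ d × d ℤ.≤ ℤ.+ 2) ds × NormZ ds × valℤ ds ≡ n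

b₄≡1 : ℤ → Set
b₄≡1 n = ExactlyOne (BalRep n)

StdRep : ℕ → List ℕ → Set
StdRep n ds = All (λ d → d ℕ.< 4) ds × NormN ds × valℕ ds ≡ n

-- If x + 4v = e + 4w for digits x, e that differ by less than 4, then x = e and v = w.
-- Each of 1, 2, 3 differs by less than 4 from each hyperquaternary digit 0, …, 4, and each of
-- -1, 0, 1 from each balanced digit -2, …, 2, so an expansion with such digits is the only one.
-- Conversely the trades 0 + 4(u + 1) = 4 + 4u and ±2 + 4v = ∓2 + 4(v ± 1) turn an expansion
-- with a digit 0 (standard) or ±2 (balanced) into a second one, and an expansion is unique only
-- if its tail is.
module Submission where

open import Defs
open import Data.Nat as ℕ using (ℕ; zero; suc; z≤n; s≤s)
open import Data.Nat.DivMod using (_%_; _/_; m≡m%n+[m/n]*n; m%n<n; m/n<m)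
open import Data.Nat.Induction using (<-wellFounded)
open import Data.Nat.Properties using (*-comm)
open import Data.Integer as ℤ using (ℤ)
open import Data.List using (List; []; _∷_; map)
open import Data.List.Properties using (∷-injectiveʳ)
open import Data.List.Relation.Unary.All using (All; []; _∷_)
import Data.List.Relation.Unary.All as All
open import Data.List.Relation.Unary.All.Properties using (map⁺)
open import Data.Product using (Σ; _×_; _,_; proj₁; proj₂)
open import Data.Sum using (_⊎_; inj₁; inj₂)
open import Data.Unit using (tt)
open import Function using (_∘_)
open import Function.Bundles using (_⇔_; mk⇔)
open import Induction.WellFounded using (Acc; acc)
open import Relation.Binary.PropositionalEquality
  using (_≡_; _≢_; refl; sym; trans; cong; subst; module ≡-Reasoning)
open import Relation.Nullary using (contradiction)
open import Relation.Nullary.Decidable using (True; toWitness; _×-dec_)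

ExactlyOne-≡ : {A : Set} {P : A → Set} {a : A} → ExactlyOne P → P a → (b : A) → P b → b ≡ a
ExactlyOne-≡ (_ , _ , unique) pa b pb = trans (unique b pb) (sym (unique _ pa))

base4-rec : (P : ℕ → Set) → P 0 →
            (∀ r q → r ℕ.< 4 → r ℕ.+ 4 ℕ.* q ≢ 0 → P q → P (r ℕ.+ 4 ℕ.* q)) →
            ∀ n → P n
base4-rec P P0 step n = go n (<-wellFounded n)
  where
  go : ∀ n → Acc ℕ._<_ n → P n
  go zero      _        = P0
  go n@(suc _) (acc rs) =
    subst P (sym n≡r+4q)
      (step (n % 4) (n / 4) (m%n<n n 4) ((λ ()) ∘ trans n≡r+4q)
            (go (n / 4) (rs (m/n<m n 4 (s≤s (s≤s z≤n))))))
    where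
    n≡r+4q : n ≡ n % 4 ℕ.+ 4 ℕ.* (n / 4)
    n≡r+4q = trans (m≡m%n+[m/n]*n n 4) (cong (n % 4 ℕ.+_) (*-comm (n / 4) 4))

module Hyperquaternary where

  open import Data.Nat using (_+_; _*_; _≤_)
  open import Data.Nat.DivMod using ([m+kn]%n≡m%n; m≤n⇒m%n≡m)
  open import Data.Nat.Properties
    using (+-identityʳ; m+n≡0⇒m≡0; m+n≡0⇒n≡0; *-suc; <⇒≤; <⇒≢; ≤-refl; ≤-pred;
           m≤n⇒m<n∨m≡n; +-cancelˡ-≡; *-cancelˡ-≡)

  -- StdRep and HyperRep are definitionally RepN (_< 4) and RepN (_≤ 4).
  RepN : (ℕ → Set) → ℕ → List ℕ → Set
  RepN P n ds = All P ds × NormN ds × valℕ ds ≡ n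

  PositiveDigit : ℕ → Set
  PositiveDigit d = 1 ≤ d × d ≤ 3

  NormN-tail : ∀ {d} ds → NormN (d ∷ ds) → NormN ds
  NormN-tail []      _    = tt
  NormN-tail (_ ∷ _) norm = norm

  NormN-∷ : ∀ {d} ds → NormN ds → d + 4 * valℕ ds ≢ 0 → NormN (d ∷ ds)
  NormN-∷ {d} []      _    d+0≢0 = d+0≢0 ∘ trans (+-identityʳ d)
  NormN-∷     (_ ∷ _) norm _     = norm

  RepN-∷ : ∀ {P d m n hs} → P d → d + 4 * m ≡ n → n ≢ 0 → RepN P m hs → RepN P n (d ∷ hs)
  RepN-∷ {hs = hs} pd refl n≢0 (all , norm , refl) = pd ∷ all , NormN-∷ hs norm n≢0 , refl

  RepN-zero : ∀ {P} ds → RepN P 0 ds → ds ≡ []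
  RepN-zero []       _                      = refl
  RepN-zero (d ∷ ds) (_ ∷ all , norm , val≡0)
    with m+n≡0⇒m≡0 d val≡0
       | RepN-zero ds (all , NormN-tail ds norm , m+n≡0⇒m≡0 (valℕ ds) (m+n≡0⇒n≡0 d val≡0))
  ... | refl | refl = contradiction refl norm

  StdRep-exists : ∀ n → Σ (List ℕ) (StdRep n)
  StdRep-exists = base4-rec (λ n → Σ (List ℕ) (StdRep n)) ([] , [] , tt , refl)
    λ r q r<4 n≢0 (hs , rep) → r ∷ hs , RepN-∷ r<4 refl n≢0 rep

  StdRep⇒HyperRep : ∀ {n ds} → StdRep n ds → HyperRep n ds
  StdRep⇒HyperRep (all , norm , val) = All.map <⇒≤ all , norm , val

  [m+4k]%4≡m%4 : ∀ m k → (m + 4 * k) % 4 ≡ m % 4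
  [m+4k]%4≡m%4 m k = trans (cong (λ y → (m + y) % 4) (*-comm 4 k)) ([m+kn]%n≡m%n m k 4)

  digit-cancel : ∀ {x e v w} → x ≤ 4 → PositiveDigit e → x + 4 * v ≡ e + 4 * w → x ≡ e × v ≡ w
  digit-cancel {x} {e} {v} {w} x≤4 (1≤e , e≤3) eq =
    x≡e , *-cancelˡ-≡ v w 4 (+-cancelˡ-≡ x _ _ (subst (λ y → x + 4 * v ≡ y + 4 * w) (sym x≡e) eq))
    where
    x%4≡e : x % 4 ≡ e
    x%4≡e = trans (sym ([m+4k]%4≡m%4 x v))
           (trans (cong (_% 4) eq) (trans ([m+4k]%4≡m%4 e w) (m≤n⇒m%n≡m e≤3)))
    x≡e : x ≡ e
    x≡e with m≤n⇒m<n∨m≡n x≤4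
    ... | inj₁ x<4  = trans (sym (m≤n⇒m%n≡m (≤-pred x<4))) x%4≡e
    ... | inj₂ refl = contradiction x%4≡e (<⇒≢ 1≤e)

  positive-digits⇒HyperRep-unique : ∀ ds → All PositiveDigit ds →
                                    ∀ xs → HyperRep (valℕ ds) xs → xs ≡ ds
  positive-digits⇒HyperRep-unique []          _   xs rep        = RepN-zero xs rep
  positive-digits⇒HyperRep-unique (suc _ ∷ _) _   [] (_ , _ , ())
  positive-digits⇒HyperRep-unique (d ∷ ds) (d∈ ∷ pos) (x ∷ xs) (x≤4 ∷ all , norm , eq)
    with digit-cancel x≤4 d∈ eq
  ... | refl , val≡ =
    cong (x ∷_) (positive-digits⇒HyperRep-unique ds pos xs (all , NormN-tail xs norm , val≡))

  HyperRep-unique⇒positive-digits : ∀ {n} ds → StdRep n ds → (∀ ys → HyperRep n ys → ys ≡ ds) →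
                                    All PositiveDigit ds
  HyperRep-unique⇒positive-digits []           _                      _      = []
  HyperRep-unique⇒positive-digits (0 ∷ [])     (_ , norm , _)         _      = contradiction refl norm
  HyperRep-unique⇒positive-digits (0 ∷ e ∷ es) (_ ∷ all , norm , val) unique
    with valℕ (e ∷ es) in val-tail
  ... | zero  = contradiction (RepN-zero (e ∷ es) (All.map <⇒≤ all , norm , val-tail)) λ ()
  ... | suc u = let hs , rep = StdRep-exists u in
    contradiction (unique (4 ∷ hs) (RepN-∷ ≤-refl (trans (sym (*-suc 4 u)) val) ((λ ()) ∘ trans val)
                                            (StdRep⇒HyperRep rep)))
                  λ ()
  HyperRep-unique⇒positive-digits (suc k ∷ ds) (d<4 ∷ all , norm , val) unique =
    (s≤s z≤n , ≤-pred d<4) ∷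
    HyperRep-unique⇒positive-digits ds (all , NormN-tail ds norm , refl) tail-unique
    where
    tail-unique : ∀ ys → HyperRep (valℕ ds) ys → ys ≡ ds
    tail-unique ys rep =
      ∷-injectiveʳ (unique (suc k ∷ ys) (RepN-∷ (<⇒≤ d<4) val ((λ ()) ∘ trans val) rep))

  f₄≡1⇔positive-digits : ∀ {n ds} → StdRep n ds → (f₄≡1 n ⇔ All PositiveDigit ds)
  f₄≡1⇔positive-digits {ds = ds} std@(_ , _ , refl) = mk⇔
    (λ one → HyperRep-unique⇒positive-digits ds std (ExactlyOne-≡ one (StdRep⇒HyperRep std)))
    (λ pos → ds , StdRep⇒HyperRep std , positive-digits⇒HyperRep-unique ds pos)

module Balanced where

  open import Data.Integer
    using (+_; -[1+_]; 0ℤ; _+_; _-_; _*_; -_; _≤_; _≤?_; +≤+; -≤-)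
  open import Data.Integer.Properties
    using (+-identityʳ; +-mono-≤; neg-mono-≤; neg-involutive; neg-injective; neg-distrib-+;
           neg-distribʳ-*; i-j≡0⇒i≡j; pos-+; pos-*; +-injective)
  open import Data.Integer.Tactic.RingSolver using (solve-∀)
  open import Data.Nat.Properties using (*-monoʳ-≤; ≤⇒≯)

  Within : ℕ → ℤ → Set
  Within k d = - + k ≤ d × d ≤ + k

  within : ∀ {k d} {p : True ((- + k ≤? d) ×-dec (d ≤? + k))} → Within k d
  within {p = p} = toWitness p

  Within-neg : ∀ {k d} → Within k d → Within k (- d)
  Within-neg {k} (-k≤d , d≤k) =
    neg-mono-≤ d≤k , subst (- _ ≤_) (neg-involutive (+ k)) (neg-mono-≤ -k≤d)

  Within₂-cases : ∀ {d} → Within 2 d → d ≡ - + 2 ⊎ Within 1 d ⊎ d ≡ + 2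
  Within₂-cases { -[1+ 1 ] }            _                      = inj₁ refl
  Within₂-cases { -[1+ 0 ] }            _                      = inj₂ (inj₁ within)
  Within₂-cases { + 0 }                 _                      = inj₂ (inj₁ within)
  Within₂-cases { + 1 }                 _                      = inj₂ (inj₁ within)
  Within₂-cases { + 2 }                 _                      = inj₂ (inj₂ refl)
  Within₂-cases { -[1+ suc (suc _) ] }  (-≤- (s≤s ()) , _)
  Within₂-cases { + suc (suc (suc _)) } (_ , +≤+ (s≤s (s≤s ())))

  NormZ-tail : ∀ {d} ds → NormZ (d ∷ ds) → NormZ ds
  NormZ-tail []      _    = tt
  NormZ-tail (_ ∷ _) norm = norm

  NormZ-∷ : ∀ {d} ds → NormZ ds → d + + 4 * valℤ ds ≢ 0ℤ → NormZ (d ∷ ds)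
  NormZ-∷ {d} []      _    d+0≢0 = d+0≢0 ∘ trans (+-identityʳ d)
  NormZ-∷     (_ ∷ _) norm _     = norm

  NormZ-neg : ∀ ds → NormZ ds → NormZ (map -_ ds)
  NormZ-neg []           _    = tt
  NormZ-neg (d ∷ [])     d≢0  = d≢0 ∘ neg-injective
  NormZ-neg (_ ∷ d ∷ ds) norm = NormZ-neg (d ∷ ds) norm

  valℤ-neg : ∀ ds → valℤ (map -_ ds) ≡ - valℤ ds
  valℤ-neg []       = refl
  valℤ-neg (d ∷ ds) = begin
    - d + + 4 * valℤ (map -_ ds) ≡⟨ cong (λ v → - d + + 4 * v) (valℤ-neg ds) ⟩
    - d + + 4 * - valℤ ds        ≡⟨ cong (λ u → - d + u) (sym (neg-distribʳ-* (+ 4) (valℤ ds))) ⟩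
    - d + - (+ 4 * valℤ ds)      ≡⟨ sym (neg-distrib-+ d _) ⟩
    - (d + + 4 * valℤ ds)        ∎
    where open ≡-Reasoning

  BalRep-∷ : ∀ {d m n hs} → Within 2 d → d + + 4 * m ≡ n → n ≢ 0ℤ →
             BalRep m hs → BalRep n (d ∷ hs)
  BalRep-∷ {hs = hs} d∈ refl n≢0 (all , norm , refl) = d∈ ∷ all , NormZ-∷ hs norm n≢0 , refl

  BalRep-neg : ∀ {n ds} → BalRep n ds → BalRep (- n) (map -_ ds)
  BalRep-neg {ds = ds} (all , norm , refl) = map⁺ (All.map Within-neg all) , NormZ-neg ds norm , valℤ-neg ds

  ∣4t∣≤3⇒t≡0 : ∀ t → - + 3 ≤ + 4 * t → + 4 * t ≤ + 3 → t ≡ 0ℤ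
  ∣4t∣≤3⇒t≡0 (+ zero)  _          _          = refl
  ∣4t∣≤3⇒t≡0 (+ suc k) _          (+≤+ 4t≤3) = contradiction (*-monoʳ-≤ 4 (s≤s (z≤n {k}))) (≤⇒≯ 4t≤3)
  ∣4t∣≤3⇒t≡0 -[1+ k ]  (-≤- 4t≤3) _          = contradiction (*-monoʳ-≤ 4 (s≤s (z≤n {k}))) (≤⇒≯ (s≤s 4t≤3))

  digit-cancel : ∀ {x e v w} → Within 2 x → Within 1 e →
                 x + + 4 * v ≡ e + + 4 * w → x ≡ e × v ≡ w
  digit-cancel {x} {e} {v} {w} (-2≤x , x≤2) (-1≤e , e≤1) eq =
    sym (i-j≡0⇒i≡j e x e-x≡0) , i-j≡0⇒i≡j v w v-w≡0
    where
    open ≡-Reasoning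
    expand : ∀ x v w → + 4 * (v - w) ≡ (x + + 4 * v) - (x + + 4 * w)
    expand = solve-∀
    cancel : ∀ e x w → (e + + 4 * w) - (x + + 4 * w) ≡ e - x
    cancel = solve-∀
    4[v-w]≡e-x : + 4 * (v - w) ≡ e - x
    4[v-w]≡e-x = begin
      + 4 * (v - w)                   ≡⟨ expand x v w ⟩
      (x + + 4 * v) - (x + + 4 * w)   ≡⟨ cong (_- (x + + 4 * w)) eq ⟩
      (e + + 4 * w) - (x + + 4 * w)   ≡⟨ cancel e x w ⟩
      e - x                           ∎
    v-w≡0 : v - w ≡ 0ℤ
    v-w≡0 = ∣4t∣≤3⇒t≡0 (v - w)
      (subst (- + 3 ≤_) (sym 4[v-w]≡e-x) (+-mono-≤ -1≤e (neg-mono-≤ x≤2)))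
      (subst (_≤ + 3)   (sym 4[v-w]≡e-x) (+-mono-≤ e≤1 (neg-mono-≤ -2≤x)))
    e-x≡0 : e - x ≡ 0ℤ
    e-x≡0 = trans (sym 4[v-w]≡e-x) (cong (+ 4 *_) v-w≡0)

  BalRep-zero : ∀ xs → BalRep 0ℤ xs → xs ≡ []
  BalRep-zero []       _                      = refl
  BalRep-zero (x ∷ xs) (x∈ ∷ all , norm , val) with digit-cancel {e = 0ℤ} {w = 0ℤ} x∈ within val
  ... | refl , val≡0 with BalRep-zero xs (all , NormZ-tail xs norm , val≡0)
  ...   | refl = contradiction refl norm

  BalRep-∷⇒≢0 : ∀ {n x xs} → BalRep n (x ∷ xs) → n ≢ 0ℤ
  BalRep-∷⇒≢0 {x = x} {xs} rep refl with () ← BalRep-zero (x ∷ xs) rep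

  BalRepOf : ℤ → Set
  BalRepOf n = Σ (List ℤ) (BalRep n)

  r+4q≡+[r+4q] : ∀ r q → + r + + 4 * + q ≡ + (r ℕ.+ 4 ℕ.* q)
  r+4q≡+[r+4q] r q = sym (trans (pos-+ r (4 ℕ.* q)) (cong (λ u → + r + u) (pos-* 4 q)))

  r-4+4[1+q]≡+[r+4q] : ∀ r q → (+ r - + 4) + + 4 * + suc q ≡ + (r ℕ.+ 4 ℕ.* q)
  r-4+4[1+q]≡+[r+4q] r q = trans (shift (+ r) (+ q)) (r+4q≡+[r+4q] r q)
    where
    shift : ∀ r q → (r - + 4) + + 4 * (+ 1 + q) ≡ r + + 4 * q
    shift = solve-∀

  -- Writing a last base-4 digit 3 as -1 carries 1 into the quotient, so the induction
  -- produces the expansions of n and n + 1 together.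
  BalRepOf-pos : ∀ n → BalRepOf (+ n) × BalRepOf (+ suc n)
  BalRepOf-pos = base4-rec _ (([] , [] , tt , refl) , (+ 1 ∷ [] , within ∷ [] , (λ ()) , refl)) step
    where
    step : ∀ r q → r ℕ.< 4 → r ℕ.+ 4 ℕ.* q ≢ 0 → BalRepOf (+ q) × BalRepOf (+ suc q) →
           BalRepOf (+ (r ℕ.+ 4 ℕ.* q)) × BalRepOf (+ suc (r ℕ.+ 4 ℕ.* q))
    step 0 q _ n≢0 ((hs , rep) , _) =
      (+ 0 ∷ hs , BalRep-∷ within (r+4q≡+[r+4q] 0 q) (n≢0 ∘ +-injective) rep) ,
      (+ 1 ∷ hs , BalRep-∷ within (r+4q≡+[r+4q] 1 q) (λ ()) rep)
    step 1 q _ _ ((hs , rep) , _) =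
      (+ 1 ∷ hs , BalRep-∷ within (r+4q≡+[r+4q] 1 q) (λ ()) rep) ,
      (+ 2 ∷ hs , BalRep-∷ within (r+4q≡+[r+4q] 2 q) (λ ()) rep)
    step 2 q _ _ ((hs , rep) , (hs′ , rep′)) =
      (+ 2 ∷ hs , BalRep-∷ within (r+4q≡+[r+4q] 2 q) (λ ()) rep) ,
      (-[1+ 0 ] ∷ hs′ , BalRep-∷ within (r-4+4[1+q]≡+[r+4q] 3 q) (λ ()) rep′)
    step 3 q _ _ (_ , (hs′ , rep′)) =
      (-[1+ 0 ] ∷ hs′ , BalRep-∷ within (r-4+4[1+q]≡+[r+4q] 3 q) (λ ()) rep′) ,
      (+ 0 ∷ hs′ , BalRep-∷ within (r-4+4[1+q]≡+[r+4q] 4 q) (λ ()) rep′)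
    step (suc (suc (suc (suc _)))) _ (s≤s (s≤s (s≤s (s≤s ())))) _ _

  BalRepOf-all : ∀ n → BalRepOf n
  BalRepOf-all (+ n)    = proj₁ (BalRepOf-pos n)
  BalRepOf-all -[1+ n ] = let ds , rep = proj₂ (BalRepOf-pos n) in map -_ ds , BalRep-neg rep

  small-digits⇒BalRep-unique : ∀ ds → All (Within 1) ds →
                               ∀ {xs ys} → BalRep (valℤ ds) xs → BalRep (valℤ ds) ys → xs ≡ ys
  small-digits⇒BalRep-unique [] _ {xs} {ys} xs-rep ys-rep =
    trans (BalRep-zero xs xs-rep) (sym (BalRep-zero ys ys-rep))
  small-digits⇒BalRep-unique (_ ∷ _) _ {[]} {ys} (_ , _ , val) (all , norm , val′) =
    sym (BalRep-zero ys (all , norm , trans val′ (sym val)))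
  small-digits⇒BalRep-unique (_ ∷ _) _ {xs} {[]} (all , norm , val) (_ , _ , val′) =
    BalRep-zero xs (all , norm , trans val (sym val′))
  small-digits⇒BalRep-unique (d ∷ ds) (d∈ ∷ small) {x ∷ xs} {y ∷ ys}
                             (x∈ ∷ xs-all , xs-norm , xs-val) (y∈ ∷ ys-all , ys-norm , ys-val)
    with digit-cancel x∈ d∈ xs-val | digit-cancel y∈ d∈ ys-val
  ... | refl , xs-val′ | refl , ys-val′ =
    cong (x ∷_) (small-digits⇒BalRep-unique ds small (xs-all , NormZ-tail xs xs-norm , xs-val′)
                                                      (ys-all , NormZ-tail ys ys-norm , ys-val′))

  BalRep-starting-with : ∀ {n} d m → Within 2 d → d + + 4 * m ≡ n → n ≢ 0ℤ →
                         Σ (List ℤ) (λ hs → BalRep n (d ∷ hs))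
  BalRep-starting-with _ m d∈ eq n≢0 = let hs , rep = BalRepOf-all m in hs , BalRep-∷ d∈ eq n≢0 rep

  trade₋₂ : ∀ v → + 2 + + 4 * (v - + 1) ≡ - + 2 + + 4 * v
  trade₋₂ = solve-∀

  trade₂ : ∀ v → - + 2 + + 4 * (v + + 1) ≡ + 2 + + 4 * v
  trade₂ = solve-∀

  BalRep-unique⇒small-digits : ∀ {n} xs → BalRep n xs → (∀ ys → BalRep n ys → ys ≡ xs) →
                               All (Within 1) xs
  BalRep-unique⇒small-digits []       _                              _      = []
  BalRep-unique⇒small-digits (x ∷ xs) rep@(x∈ ∷ all , norm , val) unique with Within₂-cases x∈
  ... | inj₁ refl =
    let _ , traded = BalRep-starting-with (+ 2) (valℤ xs - + 1) within
                                          (trans (trade₋₂ (valℤ xs)) val) (BalRep-∷⇒≢0 rep)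
    in contradiction (unique _ traded) λ ()
  ... | inj₂ (inj₂ refl) =
    let _ , traded = BalRep-starting-with (- + 2) (valℤ xs + + 1) within
                                          (trans (trade₂ (valℤ xs)) val) (BalRep-∷⇒≢0 rep)
    in contradiction (unique _ traded) λ ()
  ... | inj₂ (inj₁ x∈₁) =
    x∈₁ ∷ BalRep-unique⇒small-digits xs (all , NormZ-tail xs norm , refl) tail-unique
    where
    tail-unique : ∀ ys → BalRep (valℤ xs) ys → ys ≡ xs
    tail-unique ys ys-rep =
      ∷-injectiveʳ (unique (x ∷ ys) (BalRep-∷ x∈ val (BalRep-∷⇒≢0 rep) ys-rep))

  b₄≡1⇔small-digits : ∀ n → (b₄≡1 n ⇔ Σ (List ℤ) (λ ds → All (Within 1) ds × valℤ ds ≡ n))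
  b₄≡1⇔small-digits n = mk⇔
    (λ (xs , rep , unique) → xs , BalRep-unique⇒small-digits xs rep unique , proj₂ (proj₂ rep))
    (λ (ds , small , val) → subst b₄≡1 val (small-digits⇒b₄≡1 ds small))
    where
    small-digits⇒b₄≡1 : ∀ ds → All (Within 1) ds → b₄≡1 (valℤ ds)
    small-digits⇒b₄≡1 ds small = let xs , rep = BalRepOf-all (valℤ ds) in
      xs , rep , λ ys ys-rep → small-digits⇒BalRep-unique ds small ys-rep rep

lemma4p1 : ((n : ℕ) → 1 ℕ.≤ n → (ds : List ℕ) → StdRep n ds →
             (f₄≡1 n ⇔ All (λ d → 1 ℕ.≤ d × d ℕ.≤ 3) ds))
         × ((n : ℤ) →
             (b₄≡1 n ⇔ Σ (List ℤ) (λ ds → All (λ d → ℤ.- ℤ.+ 1 ℤ.≤ d × d ℤ.≤ ℤ.+ 1) ds × valℤ ds ≡ n)))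
lemma4p1 = (λ _ _ _ → Hyperquaternary.f₄≡1⇔positive-digits) , Balanced.b₄≡1⇔small-digits
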